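{- Fix integers $r\geq 2$ and $t\geq 1$. Let $G$ be an $r$-uniform hypergraph and let $V_1,\dots,V_n$ be a partition of $V(G)$ such that, for each $i\in\{1,\dots,n\}$, $|V_i|\geq t$ and at most $r^{ -r}(r-1)^{r-1}t^{r-1}|V_i|$ stretched edges of $G$ intersect $V_i$. Then there exist at least $\left(\frac{r-1}{r}t\right)^n$ independent transversals of $V_1,\dots,V_n$.
   Context: Hypergraphs are finite; a hypergraph $G$ has vertex set $V(G)$ and a set $E(G)$ of edges, each a subset of $V(G)$; $G$ is $r$-uniform if each edge has exactly $r$ vertices. A set $X\subseteq V(G)$ is independent if no edge of $G$ is a subset of $X$. A transversal of a partition $V_1,\dots,V_n$ of $V(G)$ is a set $X$ with $|X\cap V_i|=1$ for each $i$. An edge $e$ is stretched by $V_1,\dots,V_n$ if its vertices lie in $|e|$ distinct parts (i.e. $|e\cap V_i|\leq 1$ for all $i$). -}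

module Defs where

open import Data.Nat using (ℕ; zero; suc; _≤_; _≥_; _≟_; _≤?_)
open import Data.Bool using (true; false)
open import Data.Fin using (Fin)
import Data.Fin
open import Data.Fin.Subset using (Subset; _∩_; _⊆_; ∣_∣; Nonempty)
open import Data.Fin.Subset.Properties using (_⊆?_; nonempty?)
import Data.Fin.Properties
open import Data.List using (List; []; _∷_; _++_; map; filter; length)
open import Data.List.Relation.Unary.All using (All; all?)
open import Data.List.Relation.Unary.Unique.Propositional using (Unique)
open import Data.List.Membership.Propositional using (_∈_)
open import Data.Vec using (_∷_; []; tabulate)
open import Data.Product using (_×_)
open import Relation.Nullary using (¬_; Dec; does)
open import Relation.Nullary.Decidable using (¬?; _×-dec_)
open import Relation.Binary.PropositionalEquality using (_≡_)

record Hypergraph (m : ℕ) : Set where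
  field
    edges    : List (Subset m)
    distinct : Unique edges
open Hypergraph public

Uniform : ∀ {m} → ℕ → Hypergraph m → Set
Uniform r G = ∀ e → e ∈ edges G → ∣ e ∣ ≡ r

-- A partition V₁,…,Vₙ of Fin m is given by the map sending each vertex to its part.
-- The part V i as a subset:
part : ∀ {m n} → (Fin m → Fin n) → Fin n → Subset m
part π i = tabulate (λ v → does (π v Data.Fin.≟ i))

allSubsets : (m : ℕ) → List (Subset m)
allSubsets zero = [] ∷ []
allSubsets (suc m) = map (true ∷_) (allSubsets m) ++ map (false ∷_) (allSubsets m)

Independent : ∀ {m} → Hypergraph m → Subset m → Set
Independent G X = All (λ e → ¬ (e ⊆ X)) (edges G)

independent? : ∀ {m} (G : Hypergraph m) (X : Subset m) → Dec (Independent G X)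
independent? G X = all? (λ e → ¬? (e ⊆? X)) (edges G)

Transversal : ∀ {m n} → (Fin m → Fin n) → Subset m → Set
Transversal π X = ∀ i → ∣ X ∩ part π i ∣ ≡ 1

transversal? : ∀ {m n} (π : Fin m → Fin n) (X : Subset m) → Dec (Transversal π X)
transversal? π X = Data.Fin.Properties.all? (λ i → ∣ X ∩ part π i ∣ ≟ 1)

Stretched : ∀ {m n} → (Fin m → Fin n) → Subset m → Set
Stretched π e = ∀ i → ∣ e ∩ part π i ∣ ≤ 1

stretched? : ∀ {m n} (π : Fin m → Fin n) (e : Subset m) → Dec (Stretched π e)
stretched? π e = Data.Fin.Properties.all? (λ i → ∣ e ∩ part π i ∣ ≤? 1)

stretchedMeeting : ∀ {m n} → Hypergraph m → (Fin m → Fin n) → Fin n → ℕ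
stretchedMeeting G π i =
  length (filter (λ e → stretched? π e ×-dec nonempty? (e ∩ part π i)) (edges G))

numIndepTransversals : ∀ {m n} → Hypergraph m → (Fin m → Fin n) → ℕ
numIndepTransversals G π =
  length (filter (λ X → transversal? π X ×-dec independent? G X) (allSubsets _))

-- For a set I of parts, let #IT I count the independent sets that meet every part indexed by I
-- exactly once and every other part not at all. With a = (r-1)t and b = r we show
-- a · #IT (I - k) ≤ b · #IT I for every k ∈ I, by induction on |I|; iterating from ⊥ to ⊤ then
-- gives aⁿ ≤ bⁿ · #IT ⊤. For the inductive step, double count the pairs (X, v) with X counted by
-- #IT (I - k) and v ∈ V_k: either X ∪ {v} is independent, which happens at most #IT I times in
-- total, or some stretched edge e through v has e ∖ V_k ⊆ X. Deleting the r - 1 vertices of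
-- e ∖ V_k one at a time, the induction hypothesis bounds the number of such X by
-- (b/a)^(r-1) · #IT (I - k), and the hypothesis on the number of stretched edges meeting V_k turns
-- the total over e into |V_k| · #IT (I - k) / r. Hence (1 - 1/r) |V_k| · #IT (I - k) ≤ #IT I.

module Submission where

open import Defs
open import Level using (Level)
open import Data.Bool using (true; false; if_then_else_)
open import Data.Fin using (Fin; zero; suc)
import Data.Fin as Fin
import Data.Fin.Properties as Fin
open import Data.Fin.Subset
  using (Subset; outside; _⊆_; _∈_; _∉_; _∩_; _∪_; _─_; _-_; ⁅_⁆; ⊥; ⊤; ∣_∣; Nonempty; Empty)
open import Data.Fin.Subset.Properties
  using ( _∈?_; _⊆?_; nonempty?; Empty-unique; x∈p∧x∉q⇒x∈p─q; x∈⁅y⁆⇔x≡y; x∈⁅x⁆; ∣⁅x⁆∣≡1; ∣⊥∣≡0; ∣⊤∣≡n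
        ; ∉⊥; ∈⊤; p⊆q⇒∣p∣≤∣q∣; ∪⇔⊎; ∩⇔×; p─q⊆p; ∣p─q∣≤∣p∣; x∈p∧x≢y⇒x∈p-y; ⊆-antisym)
open import Data.List using (List; []; _∷_; _++_; length; map; filter; allFin)
open import Data.List.Properties using (length-++; length-map; map-tabulate)
open import Data.List.Membership.Propositional using (find) renaming (_∈_ to _∈ₗ_)
open import Data.List.Membership.Propositional.Properties
  using (∈-∃++; ∈-++⁺ˡ; ∈-++⁺ʳ; ∈-++⁻; ∈-map⁺; ∈-map⁻; ∈-filter⁺; ∈-filter⁻)
open import Data.List.Relation.Unary.All as All using (All; []; _∷_)
open import Data.List.Relation.Unary.All.Properties using (¬All⇒Any¬)
open import Data.List.Relation.Unary.Any using (here; there)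
open import Data.List.Relation.Unary.AllPairs using ([]; _∷_)
open import Data.List.Relation.Unary.Unique.Propositional using (Unique)
import Data.List.Relation.Unary.Unique.Propositional.Properties as Unique
open import Data.Nat using (ℕ; zero; suc; _+_; _*_; _∸_; _^_; _≤_; _≥_; z≤n; s≤s; >-nonZero)
open import Data.Nat.Properties
open import Algebra.Properties.CommutativeSemigroup +-commutativeSemigroup using (interchange)
open import Algebra.Properties.CommutativeSemigroup *-commutativeSemigroup
  using (x∙yz≈y∙xz; x∙yz≈y∙zx) renaming (interchange to *-interchange)
open import Data.Nat.Tactic.RingSolver using (solve-∀)
open import Data.Product using (_×_; _,_; proj₁; proj₂; ∃-syntax)
open import Data.Product using () renaming (map₁ to ×-map₁; map₂ to ×-map₂)
open import Data.Sum using (_⊎_; inj₁; inj₂; map₁; map₂; [_,_]′)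
open import Data.Vec using ([]; _∷_; here; there)
open import Data.Vec.Properties using (∷-injectiveʳ; lookup∘tabulate; []=⇒lookup; lookup⇒[]=)
open import Function using (_⇔_; Equivalence; mk⇔; _∘_)
open import Relation.Nullary using (Dec; yes; no; does; ¬_; contradiction)
open import Relation.Nullary.Decidable using (_×-dec_; ¬?; decidable-stable; map′)
open import Relation.Unary using (Pred; Decidable)
open import Relation.Binary.PropositionalEquality

-- Finite sums and indicators

private
  variable
    ℓ ℓ′ : Level
    A : Set ℓ
    B : Set ℓ′
    P : Set ℓ
    Q : Set ℓ′

∑ : List A → (A → ℕ) → ℕ
∑ []       f = 0
∑ (x ∷ xs) f = f x + ∑ xs f

infixl 10 ∑
syntax ∑ xs (λ x → e) = ∑[ x ∈ xs ] e

∑-mono-∈ : ∀ xs {f g : A → ℕ} → (∀ {x} → x ∈ₗ xs → f x ≤ g x) → ∑ xs f ≤ ∑ xs g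
∑-mono-∈ []       f≤g = z≤n
∑-mono-∈ (x ∷ xs) f≤g = +-mono-≤ (f≤g (here refl)) (∑-mono-∈ xs (λ x∈ → f≤g (there x∈)))

∑-mono : ∀ xs {f g : A → ℕ} → (∀ x → f x ≤ g x) → ∑ xs f ≤ ∑ xs g
∑-mono xs f≤g = ∑-mono-∈ xs (λ {x} _ → f≤g x)

∑-cong : ∀ xs {f g : A → ℕ} → (∀ x → f x ≡ g x) → ∑ xs f ≡ ∑ xs g
∑-cong []       f≡g = refl
∑-cong (x ∷ xs) f≡g = cong₂ _+_ (f≡g x) (∑-cong xs f≡g)

∑-const : ∀ (xs : List A) c → ∑[ x ∈ xs ] c ≡ length xs * c
∑-const []       c = refl
∑-const (x ∷ xs) c = cong (c +_) (∑-const xs c)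

∑-distrib-+ : ∀ xs (f g : A → ℕ) → ∑[ x ∈ xs ] (f x + g x) ≡ ∑ xs f + ∑ xs g
∑-distrib-+ []       f g = refl
∑-distrib-+ (x ∷ xs) f g =
  trans (cong (f x + g x +_) (∑-distrib-+ xs f g)) (interchange (f x) (g x) _ _)

*-distribˡ-∑ : ∀ c xs (f : A → ℕ) → c * ∑ xs f ≡ ∑[ x ∈ xs ] (c * f x)
*-distribˡ-∑ c []       f = *-zeroʳ c
*-distribˡ-∑ c (x ∷ xs) f =
  trans (*-distribˡ-+ c (f x) _) (cong (c * f x +_) (*-distribˡ-∑ c xs f))

*-distribʳ-∑ : ∀ c (xs : List A) (f : A → ℕ) → ∑ xs f * c ≡ ∑[ x ∈ xs ] (f x * c)
*-distribʳ-∑ c xs f = trans (*-comm (∑ xs f) c) (trans (*-distribˡ-∑ c xs f) (∑-cong xs (λ x → *-comm c (f x))))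

∑-zero : ∀ (xs : List A) → ∑[ x ∈ xs ] 0 ≡ 0
∑-zero []       = refl
∑-zero (x ∷ xs) = ∑-zero xs

∑-comm : ∀ (xs : List A) (ys : List B) (f : A → B → ℕ) →
         ∑[ x ∈ xs ] (∑[ y ∈ ys ] f x y) ≡ ∑[ y ∈ ys ] (∑[ x ∈ xs ] f x y)
∑-comm []       ys f = sym (∑-zero ys)
∑-comm (x ∷ xs) ys f =
  trans (cong (∑ ys (f x) +_) (∑-comm xs ys f)) (sym (∑-distrib-+ ys (f x) _))

≤-∑ : ∀ {xs x} (f : A → ℕ) → x ∈ₗ xs → f x ≤ ∑ xs f
≤-∑ f (here refl)           = m≤m+n _ _
≤-∑ {xs = y ∷ _} f (there x∈xs) = ≤-trans (≤-∑ f x∈xs) (m≤n+m _ (f y))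

∑-map : ∀ (g : A → B) xs (f : B → ℕ) → ∑ (map g xs) f ≡ ∑[ x ∈ xs ] f (g x)
∑-map g []       f = refl
∑-map g (x ∷ xs) f = cong (f (g x) +_) (∑-map g xs f)

∑-allFin-suc : ∀ m (f : Fin (suc m) → ℕ) → ∑ (allFin (suc m)) f ≡ f zero + ∑[ v ∈ allFin m ] f (suc v)
∑-allFin-suc m f =
  cong (f zero +_) (trans (cong (λ vs → ∑ vs f) (sym (map-tabulate (λ v → v) suc))) (∑-map suc (allFin m) f))

𝟙 : Dec P → ℕ
𝟙 d = if does d then 1 else 0

𝟙-yes : (d : Dec P) → P → 𝟙 d ≡ 1
𝟙-yes (yes _) _ = refl
𝟙-yes (no ¬p) p = contradiction p ¬p

𝟙-no : (d : Dec P) → ¬ P → 𝟙 d ≡ 0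
𝟙-no (yes p) ¬p = contradiction p ¬p
𝟙-no (no _)  _  = refl

𝟙≤1 : (d : Dec P) → 𝟙 d ≤ 1
𝟙≤1 (yes _) = s≤s z≤n
𝟙≤1 (no _)  = z≤n

𝟙-≤ : (d : Dec P) {x : ℕ} → (P → 1 ≤ x) → 𝟙 d ≤ x
𝟙-≤ (yes p) h = h p
𝟙-≤ (no _)  h = z≤n

𝟙-mono : (d : Dec P) (e : Dec Q) → (P → Q) → 𝟙 d ≤ 𝟙 e
𝟙-mono d e P⇒Q = 𝟙-≤ d (λ p → ≤-reflexive (sym (𝟙-yes e (P⇒Q p))))

𝟙-cong : (d : Dec P) (e : Dec Q) → P ⇔ Q → 𝟙 d ≡ 𝟙 e
𝟙-cong d e P⇔Q = ≤-antisym (𝟙-mono d e (Equivalence.to P⇔Q)) (𝟙-mono e d (Equivalence.from P⇔Q))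

𝟙-× : (d : Dec P) (e : Dec Q) → 𝟙 (d ×-dec e) ≡ 𝟙 d * 𝟙 e
𝟙-× (yes _) (yes _) = refl
𝟙-× (yes _) (no _)  = refl
𝟙-× (no _)  _       = refl

𝟙*-mono : (d : Dec P) {x y : ℕ} → (P → x ≤ y) → 𝟙 d * x ≤ 𝟙 d * y
𝟙*-mono (yes p) x≤y = *-monoʳ-≤ 1 (x≤y p)
𝟙*-mono (no _)  _   = z≤n

𝟙*-≤ : (d : Dec P) {x : ℕ} → (P → x ≤ 1) → 𝟙 d * x ≤ 𝟙 d
𝟙*-≤ (yes p) x≤1 = *-monoʳ-≤ 1 (x≤1 p)
𝟙*-≤ (no _)  _   = z≤n

does≡true⇔ : (d : Dec P) → does d ≡ true ⇔ P
does≡true⇔ (yes p) = mk⇔ (λ _ → p) (λ _ → refl)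
does≡true⇔ (no ¬p) = mk⇔ (λ ()) (λ p → contradiction p ¬p)

1≤𝟙 : (d : Dec P) → 1 ≤ 𝟙 d → P
1≤𝟙 (yes p) _ = p

length-filter≡∑𝟙 : {P : Pred A ℓ′} (P? : Decidable P) (xs : List A) → length (filter P? xs) ≡ ∑[ x ∈ xs ] 𝟙 (P? x)
length-filter≡∑𝟙 P? []       = refl
length-filter≡∑𝟙 P? (x ∷ xs) with does (P? x)
... | true  = cong suc (length-filter≡∑𝟙 P? xs)
... | false = length-filter≡∑𝟙 P? xs

Unique-⊆⇒length-≤ : {xs ys : List A} → Unique xs → (∀ {x} → x ∈ₗ xs → x ∈ₗ ys) → length xs ≤ length ys
Unique-⊆⇒length-≤ {xs = []}     _            _  = z≤n
Unique-⊆⇒length-≤ {xs = x ∷ xs} (x∉xs ∷ uxs) xs⊆ys with ∈-∃++ (xs⊆ys (here refl))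
... | ys₁ , ys₂ , refl = begin
  suc (length xs)                 ≤⟨ s≤s (Unique-⊆⇒length-≤ uxs xs⊆ys₁ys₂) ⟩
  suc (length (ys₁ ++ ys₂))       ≡⟨ cong suc (length-++ ys₁) ⟩
  suc (length ys₁ + length ys₂)   ≡⟨ +-suc (length ys₁) (length ys₂) ⟨
  length ys₁ + length (x ∷ ys₂)   ≡⟨ length-++ ys₁ ⟨
  length (ys₁ ++ x ∷ ys₂)         ∎
  where
  open ≤-Reasoning
  xs⊆ys₁ys₂ : ∀ {y} → y ∈ₗ xs → y ∈ₗ ys₁ ++ ys₂
  xs⊆ys₁ys₂ {y} y∈xs with ∈-++⁻ ys₁ (xs⊆ys (there y∈xs))
  ... | inj₁ y∈ys₁         = ∈-++⁺ˡ y∈ys₁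
  ... | inj₂ (here y≡x)    = contradiction (sym y≡x) (All.lookup x∉xs y∈xs)
  ... | inj₂ (there y∈ys₂) = ∈-++⁺ʳ ys₁ y∈ys₂

Unique-map⁺ : ∀ {P : Pred A ℓ} (f : A → B) → (∀ {x y} → P x → P y → f x ≡ f y → x ≡ y) →
              ∀ {xs} → All P xs → Unique xs → Unique (map f xs)
Unique-map⁺ f inj []         []             = []
Unique-map⁺ f inj (px ∷ pxs) (x∉xs ∷ uxs) = fx∉fxs pxs x∉xs ∷ Unique-map⁺ f inj pxs uxs
  where
  fx∉fxs : ∀ {ys} → All _ ys → All (λ y → ¬ _ ≡ y) ys → All (λ z → ¬ f _ ≡ z) (map f ys)
  fx∉fxs []         []           = []
  fx∉fxs (py ∷ pys) (x≢y ∷ x≢ys) = (λ fx≡fy → x≢y (inj px py fx≡fy)) ∷ fx∉fxs pys x≢ys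

∈-allSubsets : ∀ {m} (X : Subset m) → X ∈ₗ allSubsets m
∈-allSubsets []                = here refl
∈-allSubsets {suc m} (true ∷ X)  = ∈-++⁺ˡ (∈-map⁺ (true ∷_) (∈-allSubsets X))
∈-allSubsets {suc m} (false ∷ X) = ∈-++⁺ʳ (map (true ∷_) (allSubsets m)) (∈-map⁺ (false ∷_) (∈-allSubsets X))

allSubsets-unique : ∀ m → Unique (allSubsets m)
allSubsets-unique zero    = [] ∷ []
allSubsets-unique (suc m) =
  Unique.++⁺ (Unique.map⁺ ∷-injectiveʳ (allSubsets-unique m)) (Unique.map⁺ ∷-injectiveʳ (allSubsets-unique m))
             disjoint
  where
  disjoint : ∀ {X} → ¬ (X ∈ₗ map (true ∷_) (allSubsets m) × X ∈ₗ map (false ∷_) (allSubsets m))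
  disjoint (X∈₁ , X∈₂) with ∈-map⁻ (true ∷_) X∈₁ | ∈-map⁻ (false ∷_) X∈₂
  ... | _ , _ , refl | _ , _ , ()

#[_] : ∀ {m} {P : Pred (Subset m) ℓ} → Decidable P → ℕ
#[ P? ] = ∑[ X ∈ allSubsets _ ] 𝟙 (P? X)

#-mono : ∀ {m} {P : Pred (Subset m) ℓ} {Q : Pred (Subset m) ℓ′} (P? : Decidable P) (Q? : Decidable Q) →
         (∀ {X} → P X → Q X) → #[ P? ] ≤ #[ Q? ]
#-mono P? Q? P⇒Q = ∑-mono (allSubsets _) (λ X → 𝟙-mono (P? X) (Q? X) P⇒Q)

1≤# : ∀ {m} {P : Pred (Subset m) ℓ} (P? : Decidable P) {X} → P X → 1 ≤ #[ P? ]
1≤# P? {X} PX = ≤-trans (≤-reflexive (sym (𝟙-yes (P? X) PX))) (≤-∑ (λ Y → 𝟙 (P? Y)) (∈-allSubsets X))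

#-empty : ∀ {m} {P : Pred (Subset m) ℓ} (P? : Decidable P) → (∀ X → ¬ P X) → #[ P? ] ≡ 0
#-empty {m = m} P? ¬P = trans (∑-cong (allSubsets m) (λ X → 𝟙-no (P? X) (¬P X))) (∑-zero (allSubsets m))

#-injection : ∀ {m m'} {P : Pred (Subset m) ℓ} {Q : Pred (Subset m') ℓ′} (P? : Decidable P) (Q? : Decidable Q)
              (f : Subset m → Subset m') → (∀ {X} → P X → Q (f X)) →
              (∀ {X Y} → P X → P Y → f X ≡ f Y → X ≡ Y) → #[ P? ] ≤ #[ Q? ]
#-injection {m = m} {m'} P? Q? f P⇒Qf inj = begin
  #[ P? ]                            ≡⟨ length-filter≡∑𝟙 P? (allSubsets m) ⟨
  length Ps                          ≡⟨ length-map f Ps ⟨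
  length (map f Ps)                  ≤⟨ Unique-⊆⇒length-≤ f[Ps]-unique f[Ps]⊆Qs ⟩
  length (filter Q? (allSubsets m')) ≡⟨ length-filter≡∑𝟙 Q? (allSubsets m') ⟩
  #[ Q? ]                            ∎
  where
  open ≤-Reasoning
  Ps = filter P? (allSubsets m)
  all-P : All _ Ps
  all-P = All.tabulate (λ X∈ → proj₂ (∈-filter⁻ P? {xs = allSubsets m} X∈))
  f[Ps]-unique : Unique (map f Ps)
  f[Ps]-unique = Unique-map⁺ f inj all-P (Unique.filter⁺ P? (allSubsets-unique m))
  f[Ps]⊆Qs : ∀ {Y} → Y ∈ₗ map f Ps → Y ∈ₗ filter Q? (allSubsets m')
  f[Ps]⊆Qs Y∈ with ∈-map⁻ f Y∈
  ... | X , X∈ , refl = ∈-filter⁺ Q? (∈-allSubsets (f X)) (P⇒Qf (proj₂ (∈-filter⁻ P? {xs = allSubsets m} X∈)))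

∣p∣≡∑𝟙 : ∀ {m} (p : Subset m) → ∣ p ∣ ≡ ∑[ v ∈ allFin m ] 𝟙 (v ∈? p)
∣p∣≡∑𝟙 []          = refl
∣p∣≡∑𝟙 (true ∷ p)  = trans (cong suc (∣p∣≡∑𝟙 p)) (sym (∑-allFin-suc _ (λ v → 𝟙 (v ∈? true ∷ p))))
∣p∣≡∑𝟙 (false ∷ p) = trans (∣p∣≡∑𝟙 p) (sym (∑-allFin-suc _ (λ v → 𝟙 (v ∈? false ∷ p))))

∣p∣≡∑𝟙-via : ∀ {m} {p : Subset m} {P : Pred (Fin m) ℓ} (P? : Decidable P) →
             (∀ {v} → v ∈ p ⇔ P v) → ∣ p ∣ ≡ ∑[ v ∈ allFin m ] 𝟙 (P? v)
∣p∣≡∑𝟙-via {p = p} P? p⇔P = trans (∣p∣≡∑𝟙 p) (∑-cong (allFin _) (λ v → 𝟙-cong (v ∈? p) (P? v) p⇔P))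

∣p∣≡∣q∣+∣r∣ : ∀ {m} {p q r : Subset m} → (∀ {x} → x ∈ p ⇔ (x ∈ q ⊎ x ∈ r)) → (∀ {x} → x ∈ q → x ∉ r) →
             ∣ p ∣ ≡ ∣ q ∣ + ∣ r ∣
∣p∣≡∣q∣+∣r∣ {m} {p} {q} {r} p⇔q⊎r q∩r≡∅ = begin
  ∣ p ∣                                                ≡⟨ ∣p∣≡∑𝟙 p ⟩
  ∑[ v ∈ allFin m ] 𝟙 (v ∈? p)                         ≡⟨ ∑-cong (allFin m) 𝟙-split ⟩
  ∑[ v ∈ allFin m ] (𝟙 (v ∈? q) + 𝟙 (v ∈? r))          ≡⟨ ∑-distrib-+ (allFin m) _ _ ⟩
  ∑[ v ∈ allFin m ] 𝟙 (v ∈? q) + ∑[ v ∈ allFin m ] 𝟙 (v ∈? r) ≡⟨ cong₂ _+_ (∣p∣≡∑𝟙 q) (∣p∣≡∑𝟙 r) ⟨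
  ∣ q ∣ + ∣ r ∣                                        ∎
  where
  open ≡-Reasoning
  𝟙-split : ∀ v → 𝟙 (v ∈? p) ≡ 𝟙 (v ∈? q) + 𝟙 (v ∈? r)
  𝟙-split v with v ∈? q | v ∈? r
  ... | yes v∈q | yes v∈r = contradiction v∈r (q∩r≡∅ v∈q)
  ... | yes v∈q | no  _   = 𝟙-yes (v ∈? p) (Equivalence.from p⇔q⊎r (inj₁ v∈q))
  ... | no  _   | yes v∈r = 𝟙-yes (v ∈? p) (Equivalence.from p⇔q⊎r (inj₂ v∈r))
  ... | no  v∉q | no  v∉r = 𝟙-no (v ∈? p) (λ v∈p → [ v∉q , v∉r ]′ (Equivalence.to p⇔q⊎r v∈p))

Empty⇒∣p∣≡0 : ∀ {m} {p : Subset m} → Empty p → ∣ p ∣ ≡ 0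
Empty⇒∣p∣≡0 {m} p≡∅ = trans (cong ∣_∣ (Empty-unique p≡∅)) (∣⊥∣≡0 m)

1≤∣p∣⇒Nonempty : ∀ {m} (p : Subset m) → 1 ≤ ∣ p ∣ → Nonempty p
1≤∣p∣⇒Nonempty p 1≤∣p∣ with nonempty? p
... | yes ne = ne
... | no  p≡∅ = contradiction (Empty⇒∣p∣≡0 p≡∅) (λ ∣p∣≡0 → <⇒≢ 1≤∣p∣ (sym ∣p∣≡0))

x∈p─q⇒x∉q : ∀ {m} {p q : Subset m} {x} → x ∈ p ─ q → x ∉ q
x∈p─q⇒x∉q {p = _ ∷ _} {outside ∷ _} here        ()
x∈p─q⇒x∉q {p = _ ∷ _} {_       ∷ _} (there x∈) (there x∈q) = x∈p─q⇒x∉q x∈ x∈q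

x∈p⇔x∈p-y⊎x≡y : ∀ {m} {p : Subset m} {x y} → y ∈ p → x ∈ p ⇔ (x ∈ p - y ⊎ x ≡ y)
x∈p⇔x∈p-y⊎x≡y {p = p} {x} {y} y∈p = mk⇔ to from
  where
  to : x ∈ p → x ∈ p - y ⊎ x ≡ y
  to x∈p with x Fin.≟ y
  ... | yes x≡y = inj₂ x≡y
  ... | no  x≢y = inj₁ (x∈p∧x≢y⇒x∈p-y x∈p x≢y)
  from : x ∈ p - y ⊎ x ≡ y → x ∈ p
  from (inj₁ x∈p-y) = p─q⊆p p ⁅ y ⁆ x∈p-y
  from (inj₂ refl)  = y∈p

x∉p-x : ∀ {m} (p : Subset m) x → x ∉ p - x
x∉p-x p x x∈p-x = x∈p─q⇒x∉q x∈p-x (x∈⁅x⁆ x)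

x∈p-y⇒x≢y : ∀ {m} {p : Subset m} {x y} → x ∈ p - y → x ≢ y
x∈p-y⇒x≢y {y = y} x∈p-y refl = x∉p-x _ y x∈p-y

p⊆q⇒p-x⊆q-x : ∀ {m} {p q : Subset m} {x} → p ⊆ q → p - x ⊆ q - x
p⊆q⇒p-x⊆q-x {p = p} {x = x} p⊆q y∈p-x = x∈p∧x≢y⇒x∈p-y (p⊆q (p─q⊆p p ⁅ x ⁆ y∈p-x)) (x∈p-y⇒x≢y y∈p-x)

p-x-injective : ∀ {m} {p q : Subset m} {x} → x ∈ p → x ∈ q → p - x ≡ q - x → p ≡ q
p-x-injective {x = x} x∈p x∈q p-x≡q-x = ⊆-antisym (⊆-via x∈q p-x≡q-x) (⊆-via x∈p (sym p-x≡q-x))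
  where
  ⊆-via : ∀ {p q} → x ∈ q → p - x ≡ q - x → p ⊆ q
  ⊆-via {q = q} x∈q eq {y} y∈p with y Fin.≟ x
  ... | yes refl = x∈q
  ... | no  y≢x  = p─q⊆p q ⁅ x ⁆ (subst (y ∈_) eq (x∈p∧x≢y⇒x∈p-y y∈p y≢x))

x∈p⇒1≤∣p∣ : ∀ {m} {p : Subset m} {x} → x ∈ p → 1 ≤ ∣ p ∣
x∈p⇒1≤∣p∣ {x = x} x∈p =
  subst (_≤ _) (∣⁅x⁆∣≡1 x) (p⊆q⇒∣p∣≤∣q∣ (λ y∈⁅x⁆ → subst (_∈ _) (sym (Equivalence.to x∈⁅y⁆⇔x≡y y∈⁅x⁆)) x∈p))

∣∣-cong : ∀ {m} {p q : Subset m} → (∀ {y} → y ∈ p ⇔ y ∈ q) → ∣ p ∣ ≡ ∣ q ∣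
∣∣-cong p⇔q = cong ∣_∣ (⊆-antisym (Equivalence.to p⇔q) (Equivalence.from p⇔q))

∣∣-insert : ∀ {m} {p q : Subset m} {x} → (∀ {y} → y ∈ p ⇔ (y ∈ q ⊎ y ≡ x)) → x ∉ q → ∣ p ∣ ≡ suc ∣ q ∣
∣∣-insert {p = p} {q} {x} p⇔q⊎x x∉q =
  trans (∣p∣≡∣q∣+∣r∣ p⇔q⊎⁅x⁆ (λ y∈q y∈⁅x⁆ → x∉q (subst (_∈ q) (Equivalence.to x∈⁅y⁆⇔x≡y y∈⁅x⁆) y∈q)))
        (trans (cong (∣ q ∣ +_) (∣⁅x⁆∣≡1 x)) (+-comm ∣ q ∣ 1))
  where
  p⇔q⊎⁅x⁆ : ∀ {y} → y ∈ p ⇔ (y ∈ q ⊎ y ∈ ⁅ x ⁆)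
  p⇔q⊎⁅x⁆ = mk⇔ (map₂ (Equivalence.from x∈⁅y⁆⇔x≡y) ∘ Equivalence.to p⇔q⊎x)
                (Equivalence.from p⇔q⊎x ∘ map₂ (Equivalence.to x∈⁅y⁆⇔x≡y))

x∈p∪⁅y⁆⇔ : ∀ {m} {p : Subset m} {x y} → x ∈ p ∪ ⁅ y ⁆ ⇔ (x ∈ p ⊎ x ≡ y)
x∈p∪⁅y⁆⇔ = mk⇔ (map₂ (Equivalence.to x∈⁅y⁆⇔x≡y) ∘ Equivalence.to ∪⇔⊎)
               (Equivalence.from ∪⇔⊎ ∘ map₂ (Equivalence.from x∈⁅y⁆⇔x≡y))

𝟙-∈-remove : ∀ {n} {I : Subset n} {k} → k ∈ I → ∀ i → 𝟙 (k Fin.≟ i) + 𝟙 (i ∈? I - k) ≡ 𝟙 (i ∈? I)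
𝟙-∈-remove {I = I} {k} k∈I i with k Fin.≟ i
... | yes refl = trans (cong suc (𝟙-no (k ∈? I - k) (x∉p-x I k))) (sym (𝟙-yes (k ∈? I) k∈I))
... | no  k≢i  = 𝟙-cong (i ∈? I - k) (i ∈? I) (mk⇔ (λ i∈ → Equivalence.from (x∈p⇔x∈p-y⊎x≡y k∈I) (inj₁ i∈))
  (λ i∈I → [ (λ i∈ → i∈) , (λ i≡k → contradiction (sym i≡k) k≢i) ]′ (Equivalence.to (x∈p⇔x∈p-y⊎x≡y k∈I) i∈I)))

∣p∣≡1+∣p-x∣ : ∀ {m} {p : Subset m} {x} → x ∈ p → ∣ p ∣ ≡ suc ∣ p - x ∣
∣p∣≡1+∣p-x∣ {p = p} {x} x∈p = ∣∣-insert (x∈p⇔x∈p-y⊎x≡y x∈p) (x∉p-x p x)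

∣p∣≡0⇒p≡⊥ : ∀ {m} {p : Subset m} → ∣ p ∣ ≡ 0 → p ≡ ⊥
∣p∣≡0⇒p≡⊥ ∣p∣≡0 = Empty-unique (λ (x , x∈p) → contradiction (trans (sym ∣p∣≡0) (∣p∣≡1+∣p-x∣ x∈p)) λ ())

∣p∣≡∣p∩q∣+∣p─q∣ : ∀ {m} (p q : Subset m) → ∣ p ∣ ≡ ∣ p ∩ q ∣ + ∣ p ─ q ∣
∣p∣≡∣p∩q∣+∣p─q∣ p q =
  ∣p∣≡∣q∣+∣r∣ (mk⇔ split join) (λ x∈p∩q x∈p─q → x∈p─q⇒x∉q x∈p─q (proj₂ (Equivalence.to ∩⇔× x∈p∩q)))
  where
  split : ∀ {x} → x ∈ p → x ∈ p ∩ q ⊎ x ∈ p ─ q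
  split {x} x∈p with x ∈? q
  ... | yes x∈q = inj₁ (Equivalence.from ∩⇔× (x∈p , x∈q))
  ... | no  x∉q = inj₂ (x∈p∧x∉q⇒x∈p─q x∈p x∉q)
  join : ∀ {x} → x ∈ p ∩ q ⊎ x ∈ p ─ q → x ∈ p
  join (inj₁ x∈p∩q) = proj₁ (Equivalence.to ∩⇔× x∈p∩q)
  join (inj₂ x∈p─q) = p─q⊆p p q x∈p─q

p∪⁅x⁆-injective : ∀ {m} {p q : Subset m} {x} → x ∉ p → x ∉ q → p ∪ ⁅ x ⁆ ≡ q ∪ ⁅ x ⁆ → p ≡ q
p∪⁅x⁆-injective {x = x} x∉p x∉q eq = ⊆-antisym (⊆-via x∉p eq) (⊆-via x∉q (sym eq))
  where
  ⊆-via : ∀ {p q} → x ∉ p → p ∪ ⁅ x ⁆ ≡ q ∪ ⁅ x ⁆ → p ⊆ q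
  ⊆-via x∉p eq {y} y∈p
    with Equivalence.to x∈p∪⁅y⁆⇔ (subst (y ∈_) eq (Equivalence.from x∈p∪⁅y⁆⇔ (inj₁ y∈p)))
  ... | inj₁ y∈q  = y∈q
  ... | inj₂ refl = contradiction y∈p x∉p

-- Partial transversals

module Partition {m n} (π : Fin m → Fin n) where

  ∈-part : ∀ {v i} → v ∈ part π i ⇔ π v ≡ i
  ∈-part {v} {i} = mk⇔
    (λ v∈ → Equivalence.to (does≡true⇔ (π v Fin.≟ i)) (trans (sym (lookup∘tabulate _ v)) ([]=⇒lookup v∈)))
    (λ πv≡i → lookup⇒[]= v _ (trans (lookup∘tabulate _ v) (Equivalence.from (does≡true⇔ (π v Fin.≟ i)) πv≡i)))

  ∣part∣≡∑ : ∀ i → ∣ part π i ∣ ≡ ∑[ v ∈ allFin m ] 𝟙 (π v Fin.≟ i)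
  ∣part∣≡∑ i = ∣p∣≡∑𝟙-via (λ v → π v Fin.≟ i) ∈-part

  ∣∩part∣≡∑ : ∀ Y i → ∣ Y ∩ part π i ∣ ≡ ∑[ v ∈ allFin m ] (𝟙 (v ∈? Y) * 𝟙 (π v Fin.≟ i))
  ∣∩part∣≡∑ Y i = trans (∣p∣≡∑𝟙-via (λ v → v ∈? Y ×-dec π v Fin.≟ i) ∩⇔∈×≡)
                        (∑-cong (allFin m) (λ v → 𝟙-× (v ∈? Y) (π v Fin.≟ i)))
    where
    ∩⇔∈×≡ : ∀ {v} → v ∈ Y ∩ part π i ⇔ (v ∈ Y × π v ≡ i)
    ∩⇔∈×≡ = mk⇔ (×-map₂ (Equivalence.to ∈-part) ∘ Equivalence.to ∩⇔×)
                (Equivalence.from ∩⇔× ∘ ×-map₂ (Equivalence.from ∈-part))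

  ∑-part-weighted : ∀ (xs : List A) (Y : A → Subset m) (c : A → ℕ) k →
    ∑[ v ∈ allFin m ] (𝟙 (π v Fin.≟ k) * ∑[ x ∈ xs ] (c x * 𝟙 (v ∈? Y x))) ≡ ∑[ x ∈ xs ] (c x * ∣ Y x ∩ part π k ∣)
  ∑-part-weighted xs Y c k = begin
    ∑[ v ∈ allFin m ] (𝟙 (π v Fin.≟ k) * ∑[ x ∈ xs ] (c x * 𝟙 (v ∈? Y x)))
      ≡⟨ ∑-cong (allFin m) (λ v → *-distribˡ-∑ (𝟙 (π v Fin.≟ k)) xs _) ⟩
    ∑[ v ∈ allFin m ] (∑[ x ∈ xs ] (𝟙 (π v Fin.≟ k) * (c x * 𝟙 (v ∈? Y x))))
      ≡⟨ ∑-comm (allFin m) xs _ ⟩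
    ∑[ x ∈ xs ] (∑[ v ∈ allFin m ] (𝟙 (π v Fin.≟ k) * (c x * 𝟙 (v ∈? Y x))))
      ≡⟨ ∑-cong xs (λ x → ∑-cong (allFin m) (λ v → x∙yz≈y∙zx (𝟙 (π v Fin.≟ k)) (c x) _)) ⟩
    ∑[ x ∈ xs ] (∑[ v ∈ allFin m ] (c x * (𝟙 (v ∈? Y x) * 𝟙 (π v Fin.≟ k))))
      ≡⟨ ∑-cong xs (λ x → trans (sym (*-distribˡ-∑ (c x) (allFin m) _))
                                (cong (c x *_) (sym (∣∩part∣≡∑ (Y x) k)))) ⟩
    ∑[ x ∈ xs ] (c x * ∣ Y x ∩ part π k ∣) ∎
    where open ≡-Reasoning

  ∣∩part∣-insert : ∀ {X Y v} → (∀ {y} → y ∈ Y ⇔ (y ∈ X ⊎ y ≡ v)) → v ∉ X →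
                   ∀ i → ∣ Y ∩ part π i ∣ ≡ 𝟙 (π v Fin.≟ i) + ∣ X ∩ part π i ∣
  ∣∩part∣-insert {X} {Y} {v} Y⇔X⊎v v∉X i with π v Fin.≟ i
  ... | yes πv≡i = ∣∣-insert (mk⇔ to from) (v∉X ∘ proj₁ ∘ Equivalence.to ∩⇔×)
    where
    to : ∀ {y} → y ∈ Y ∩ part π i → y ∈ X ∩ part π i ⊎ y ≡ v
    to y∈ with Equivalence.to ∩⇔× y∈
    ... | y∈Y , y∈Vᵢ = map₁ (λ y∈X → Equivalence.from ∩⇔× (y∈X , y∈Vᵢ)) (Equivalence.to Y⇔X⊎v y∈Y)
    from : ∀ {y} → y ∈ X ∩ part π i ⊎ y ≡ v → y ∈ Y ∩ part π i
    from (inj₁ y∈) with Equivalence.to ∩⇔× y∈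
    ... | y∈X , y∈Vᵢ = Equivalence.from ∩⇔× (Equivalence.from Y⇔X⊎v (inj₁ y∈X) , y∈Vᵢ)
    from (inj₂ refl) = Equivalence.from ∩⇔× (Equivalence.from Y⇔X⊎v (inj₂ refl) , Equivalence.from ∈-part πv≡i)
  ... | no  πv≢i = ∣∣-cong (mk⇔ to from)
    where
    to : ∀ {y} → y ∈ Y ∩ part π i → y ∈ X ∩ part π i
    to y∈ with Equivalence.to ∩⇔× y∈
    ... | y∈Y , y∈Vᵢ with Equivalence.to Y⇔X⊎v y∈Y
    ...   | inj₁ y∈X  = Equivalence.from ∩⇔× (y∈X , y∈Vᵢ)
    ...   | inj₂ refl = contradiction (Equivalence.to ∈-part y∈Vᵢ) πv≢i
    from : ∀ {y} → y ∈ X ∩ part π i → y ∈ Y ∩ part π i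
    from y∈ with Equivalence.to ∩⇔× y∈
    ... | y∈X , y∈Vᵢ = Equivalence.from ∩⇔× (Equivalence.from Y⇔X⊎v (inj₁ y∈X) , y∈Vᵢ)

  record PartialTransversal (I : Subset n) (X : Subset m) : Set where
    constructor mkPartialTransversal
    field part-count : ∀ i → ∣ X ∩ part π i ∣ ≡ 𝟙 (i ∈? I)

  open PartialTransversal

  partialTransversal? : ∀ I X → Dec (PartialTransversal I X)
  partialTransversal? I X = map′ mkPartialTransversal part-count (Fin.all? (λ i → ∣ X ∩ part π i ∣ ≟ 𝟙 (i ∈? I)))

  partialTransversal⇒∈ : ∀ {I X v} → PartialTransversal I X → v ∈ X → π v ∈ I
  partialTransversal⇒∈ {I} {X} {v} X-pt v∈X = 1≤𝟙 (π v ∈? I) (begin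
    1                          ≤⟨ x∈p⇒1≤∣p∣ (Equivalence.from ∩⇔× (v∈X , Equivalence.from ∈-part refl)) ⟩
    ∣ X ∩ part π (π v) ∣        ≡⟨ part-count X-pt (π v) ⟩
    𝟙 (π v ∈? I)               ∎)
    where open ≤-Reasoning

  partialTransversal-∉ : ∀ {I X k v} → PartialTransversal (I - k) X → π v ≡ k → v ∉ X
  partialTransversal-∉ {I} {k = k} X-pt refl v∈X = x∉p-x I k (partialTransversal⇒∈ X-pt v∈X)

  partialTransversal-insert : ∀ {I X k v} → PartialTransversal (I - k) X → k ∈ I → π v ≡ k →
                              PartialTransversal I (X ∪ ⁅ v ⁆)
  partialTransversal-insert {I} {X} {k} {v} X-pt k∈I refl = mkPartialTransversal λ i → begin
    ∣ (X ∪ ⁅ v ⁆) ∩ part π i ∣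
      ≡⟨ ∣∩part∣-insert {X} {X ∪ ⁅ v ⁆} x∈p∪⁅y⁆⇔ (partialTransversal-∉ X-pt refl) i ⟩
    𝟙 (π v Fin.≟ i) + ∣ X ∩ part π i ∣ ≡⟨ cong (𝟙 (π v Fin.≟ i) +_) (part-count X-pt i) ⟩
    𝟙 (π v Fin.≟ i) + 𝟙 (i ∈? I - k)   ≡⟨ 𝟙-∈-remove {I = I} k∈I i ⟩
    𝟙 (i ∈? I)                          ∎
    where open ≡-Reasoning

  partialTransversal-remove : ∀ {I X u} → PartialTransversal I X → u ∈ X → PartialTransversal (I - π u) (X - u)
  partialTransversal-remove {I} {X} {u} X-pt u∈X =
    mkPartialTransversal λ i → +-cancelˡ-≡ (𝟙 (π u Fin.≟ i)) _ _ (begin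
    𝟙 (π u Fin.≟ i) + ∣ (X - u) ∩ part π i ∣ ≡⟨ ∣∩part∣-insert {X - u} {X} (x∈p⇔x∈p-y⊎x≡y u∈X) (x∉p-x X u) i ⟨
    ∣ X ∩ part π i ∣                          ≡⟨ part-count X-pt i ⟩
    𝟙 (i ∈? I)                               ≡⟨ 𝟙-∈-remove {I = I} (partialTransversal⇒∈ X-pt u∈X) i ⟨
    𝟙 (π u Fin.≟ i) + 𝟙 (i ∈? I - π u)       ∎)
    where open ≡-Reasoning

  partialTransversal-⊥ : PartialTransversal ⊥ ⊥
  partialTransversal-⊥ = mkPartialTransversal λ i →
    trans (Empty⇒∣p∣≡0 {p = ⊥ ∩ part π i} (λ (_ , x∈) → ∉⊥ (proj₁ (Equivalence.to ∩⇔× x∈))))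
          (sym (𝟙-no (i ∈? ⊥) ∉⊥))

  partialTransversal-⊤ : ∀ {X} → PartialTransversal ⊤ X → Transversal π X
  partialTransversal-⊤ X-pt i = trans (part-count X-pt i) (𝟙-yes (i ∈? ⊤) ∈⊤)

  partialTransversal⇒stretched : ∀ {I X e} → PartialTransversal I X → e ⊆ X → Stretched π e
  partialTransversal⇒stretched {I} {X} {e} X-pt e⊆X i = begin
    ∣ e ∩ part π i ∣ ≤⟨ p⊆q⇒∣p∣≤∣q∣ (Equivalence.from ∩⇔× ∘ ×-map₁ e⊆X ∘ Equivalence.to ∩⇔×) ⟩
    ∣ X ∩ part π i ∣ ≡⟨ part-count X-pt i ⟩
    𝟙 (i ∈? I)       ≤⟨ 𝟙≤1 (i ∈? I) ⟩
    1                ∎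
    where open ≤-Reasoning

independent-⊆ : ∀ {m} {G : Hypergraph m} {X Y} → Independent G X → Y ⊆ X → Independent G Y
independent-⊆ X-ind Y⊆X = All.map (λ e⊈X e⊆Y → e⊈X (λ v∈e → Y⊆X (e⊆Y v∈e))) X-ind

independent-⊥ : ∀ {m} (G : Hypergraph m) → (∀ {e} → e ∈ₗ edges G → Nonempty e) → Independent G ⊥
independent-⊥ G nonempty = All.tabulate (λ e∈G e⊆⊥ → let (v , v∈e) = nonempty e∈G in ∉⊥ (e⊆⊥ v∈e))

module IndependentTransversals {m n} (G : Hypergraph m) (π : Fin m → Fin n) where

  open Partition π

  IndependentTransversal : Subset n → Subset m → Set
  IndependentTransversal I X = PartialTransversal I X × Independent G X

  independentTransversal? : ∀ I X → Dec (IndependentTransversal I X)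
  independentTransversal? I X = partialTransversal? I X ×-dec independent? G X

  independentTransversal⊇? : ∀ I e X → Dec (IndependentTransversal I X × e ⊆ X)
  independentTransversal⊇? I e X = independentTransversal? I X ×-dec e ⊆? X

  extendableBy? : ∀ I v X → Dec (IndependentTransversal I X × Independent G (X ∪ ⁅ v ⁆))
  extendableBy? I v X = independentTransversal? I X ×-dec independent? G (X ∪ ⁅ v ⁆)

  independentTransversal∋? : ∀ I v Y → Dec (IndependentTransversal I Y × v ∈ Y)
  independentTransversal∋? I v Y = independentTransversal? I Y ×-dec v ∈? Y

  #IT : Subset n → ℕ
  #IT I = #[ independentTransversal? I ]

  #IT⊇ : Subset n → Subset m → ℕ
  #IT⊇ I e = #[ independentTransversal⊇? I e ]

  stretchedMeeting? : ∀ k e → Dec (Stretched π e × Nonempty (e ∩ part π k))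
  stretchedMeeting? k e = stretched? π e ×-dec nonempty? (e ∩ part π k)

  stretchedMeetingEdges : Fin n → List (Subset m)
  stretchedMeetingEdges k = filter (stretchedMeeting? k) (edges G)

  #IT⊇≤#IT : ∀ I e → #IT⊇ I e ≤ #IT I
  #IT⊇≤#IT I e = #-mono (independentTransversal⊇? I e) (independentTransversal? I) proj₁

  #IT⊇-remove : ∀ {I e u} → u ∈ e → #IT⊇ I e ≤ #IT⊇ (I - π u) (e - u)
  #IT⊇-remove {I} {e} {u} u∈e =
    #-injection (independentTransversal⊇? I e) (independentTransversal⊇? (I - π u) (e - u)) (_- u) remove-u
      (λ (_ , e⊆X) (_ , e⊆Y) → p-x-injective (e⊆X u∈e) (e⊆Y u∈e))
    where
    remove-u : ∀ {X} → IndependentTransversal I X × e ⊆ X →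
               IndependentTransversal (I - π u) (X - u) × e - u ⊆ X - u
    remove-u {X} ((X-pt , X-ind) , e⊆X) =
      (partialTransversal-remove X-pt (e⊆X u∈e) , independent-⊆ {G = G} X-ind (p─q⊆p X ⁅ u ⁆)) , p⊆q⇒p-x⊆q-x e⊆X

  #IT⊇-∉ : ∀ {I e u} → u ∈ e → π u ∉ I → #IT⊇ I e ≡ 0
  #IT⊇-∉ {I} {e} u∈e πu∉I =
    #-empty (independentTransversal⊇? I e) (λ X ((X-pt , _) , e⊆X) → πu∉I (partialTransversal⇒∈ X-pt (e⊆X u∈e)))

  blocking-edge : ∀ {I k v X} → k ∈ I → π v ≡ k → PartialTransversal (I - k) X → Independent G X →
                  ¬ Independent G (X ∪ ⁅ v ⁆) → ∃[ e ] (e ∈ₗ stretchedMeetingEdges k × v ∈ e × e ─ part π k ⊆ X)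
  blocking-edge {I} {k} {v} {X} k∈I πv≡k X-pt X-ind ¬Xv-ind
    with find (¬All⇒Any¬ (λ e → ¬? (e ⊆? X ∪ ⁅ v ⁆)) (edges G) ¬Xv-ind)
  ... | e , e∈G , ¬¬e⊆Xv = e , ∈-filter⁺ (stretchedMeeting? k) e∈G (stretched , meets) , v∈e , e─Vₖ⊆X
    where
    e⊆Xv : e ⊆ X ∪ ⁅ v ⁆
    e⊆Xv = decidable-stable (e ⊆? X ∪ ⁅ v ⁆) ¬¬e⊆Xv
    ∈X⊎≡v : ∀ {y} → y ∈ e → y ∈ X ⊎ y ≡ v
    ∈X⊎≡v y∈e = Equivalence.to x∈p∪⁅y⁆⇔ (e⊆Xv y∈e)
    v∈e : v ∈ e
    v∈e = decidable-stable (v ∈? e) (λ v∉e → All.lookup X-ind e∈G (λ y∈e →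
      [ (λ y∈X → y∈X) , (λ { refl → contradiction y∈e v∉e }) ]′ (∈X⊎≡v y∈e)))
    stretched : Stretched π e
    stretched = partialTransversal⇒stretched (partialTransversal-insert X-pt k∈I πv≡k) e⊆Xv
    meets : Nonempty (e ∩ part π k)
    meets = v , Equivalence.from ∩⇔× (v∈e , Equivalence.from ∈-part πv≡k)
    e─Vₖ⊆X : e ─ part π k ⊆ X
    e─Vₖ⊆X y∈ with ∈X⊎≡v (p─q⊆p e _ y∈)
    ... | inj₁ y∈X  = y∈X
    ... | inj₂ refl = contradiction (Equivalence.from ∈-part πv≡k) (x∈p─q⇒x∉q y∈)

  extends-or-blocked : ∀ {I k v} → k ∈ I → π v ≡ k → ∀ X →
    𝟙 (independentTransversal? (I - k) X)
      ≤ 𝟙 (extendableBy? (I - k) v X)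
        + ∑[ e ∈ stretchedMeetingEdges k ] (𝟙 (independentTransversal⊇? (I - k) (e ─ part π k) X) * 𝟙 (v ∈? e))
  extends-or-blocked {I} {k} {v} k∈I πv≡k X =
    𝟙-≤ (independentTransversal? (I - k) X) (λ X-it → witnessed X-it (independent? G (X ∪ ⁅ v ⁆)))
    where
    blocked-by : Subset m → ℕ
    blocked-by e = 𝟙 (independentTransversal⊇? (I - k) (e ─ part π k) X) * 𝟙 (v ∈? e)
    witnessed : IndependentTransversal (I - k) X → Dec (Independent G (X ∪ ⁅ v ⁆)) →
                1 ≤ 𝟙 (extendableBy? (I - k) v X) + ∑[ e ∈ stretchedMeetingEdges k ] blocked-by e
    witnessed X-it (yes Xv-ind) =
      ≤-trans (≤-reflexive (sym (𝟙-yes (extendableBy? (I - k) v X) (X-it , Xv-ind))))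
              (m≤m+n (𝟙 (extendableBy? (I - k) v X)) _)
    witnessed X-it (no ¬Xv-ind) with blocking-edge k∈I πv≡k (proj₁ X-it) (proj₂ X-it) ¬Xv-ind
    ... | e , e∈Eₖ , v∈e , e─Vₖ⊆X =
      ≤-trans (≤-trans (≤-reflexive (sym blocked-by-e≡1)) (≤-∑ blocked-by e∈Eₖ)) (m≤n+m _ _)
      where
      blocked-by-e≡1 : blocked-by e ≡ 1
      blocked-by-e≡1 =
        cong₂ _*_ (𝟙-yes (independentTransversal⊇? (I - k) (e ─ part π k) X) (X-it , e─Vₖ⊆X)) (𝟙-yes (v ∈? e) v∈e)

  #IT-insert : ∀ {I k v} → k ∈ I → π v ≡ k →
    #[ extendableBy? (I - k) v ] ≤ ∑[ Y ∈ allSubsets m ] (𝟙 (independentTransversal? I Y) * 𝟙 (v ∈? Y))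
  #IT-insert {I} {k} {v} k∈I πv≡k = begin
    #[ extendableBy? (I - k) v ]
      ≤⟨ #-injection (extendableBy? (I - k) v) (independentTransversal∋? I v) (_∪ ⁅ v ⁆) insert-v
           (λ ((X-pt , _) , _) ((Y-pt , _) , _) →
              p∪⁅x⁆-injective (partialTransversal-∉ X-pt πv≡k) (partialTransversal-∉ Y-pt πv≡k)) ⟩
    #[ independentTransversal∋? I v ]
      ≡⟨ ∑-cong (allSubsets m) (λ Y → 𝟙-× (independentTransversal? I Y) (v ∈? Y)) ⟩
    ∑[ Y ∈ allSubsets m ] (𝟙 (independentTransversal? I Y) * 𝟙 (v ∈? Y)) ∎
    where
    open ≤-Reasoning
    insert-v : ∀ {X} → IndependentTransversal (I - k) X × Independent G (X ∪ ⁅ v ⁆) →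
               IndependentTransversal I (X ∪ ⁅ v ⁆) × v ∈ X ∪ ⁅ v ⁆
    insert-v ((X-pt , _) , Xv-ind) =
      (partialTransversal-insert X-pt k∈I πv≡k , Xv-ind) , Equivalence.from x∈p∪⁅y⁆⇔ (inj₂ refl)

  #IT-remove-vertex : ∀ {I k v} → k ∈ I → π v ≡ k →
    #IT (I - k) ≤ ∑[ Y ∈ allSubsets m ] (𝟙 (independentTransversal? I Y) * 𝟙 (v ∈? Y))
                  + ∑[ e ∈ stretchedMeetingEdges k ] (#IT⊇ (I - k) (e ─ part π k) * 𝟙 (v ∈? e))
  #IT-remove-vertex {I} {k} {v} k∈I πv≡k = begin
    #IT (I - k)
      ≤⟨ ∑-mono (allSubsets m) (extends-or-blocked k∈I πv≡k) ⟩
    ∑[ X ∈ allSubsets m ] (𝟙 (extends? X) + ∑[ e ∈ Eₖ ] (𝟙 (containing? e X) * 𝟙 (v ∈? e)))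
      ≡⟨ ∑-distrib-+ (allSubsets m) _ _ ⟩
    #[ extends? ] + ∑[ X ∈ allSubsets m ] (∑[ e ∈ Eₖ ] (𝟙 (containing? e X) * 𝟙 (v ∈? e)))
      ≡⟨ cong (#[ extends? ] +_) (∑-comm (allSubsets m) Eₖ _) ⟩
    #[ extends? ] + ∑[ e ∈ Eₖ ] (∑[ X ∈ allSubsets m ] (𝟙 (containing? e X) * 𝟙 (v ∈? e)))
      ≡⟨ cong (#[ extends? ] +_) (∑-cong Eₖ (λ e → *-distribʳ-∑ (𝟙 (v ∈? e)) (allSubsets m) _)) ⟨
    #[ extends? ] + ∑[ e ∈ Eₖ ] (#IT⊇ (I - k) (e ─ part π k) * 𝟙 (v ∈? e))
      ≤⟨ +-monoˡ-≤ _ (#IT-insert k∈I πv≡k) ⟩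
    ∑[ Y ∈ allSubsets m ] (𝟙 (independentTransversal? I Y) * 𝟙 (v ∈? Y))
      + ∑[ e ∈ Eₖ ] (#IT⊇ (I - k) (e ─ part π k) * 𝟙 (v ∈? e)) ∎
    where
    open ≤-Reasoning
    Eₖ = stretchedMeetingEdges k
    extends? = extendableBy? (I - k) v
    containing? = λ e → independentTransversal⊇? (I - k) (e ─ part π k)

  -- Summing #IT-remove-vertex over v ∈ V_k: a set counted by #IT I contains exactly one such v,
  -- and a stretched edge at most one.
  #IT-step : ∀ {I k} → k ∈ I →
    ∣ part π k ∣ * #IT (I - k) ≤ #IT I + ∑[ e ∈ stretchedMeetingEdges k ] #IT⊇ (I - k) (e ─ part π k)
  #IT-step {I} {k} k∈I = begin
    ∣ part π k ∣ * #IT (I - k)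
      ≡⟨ trans (cong (_* #IT (I - k)) (∣part∣≡∑ k)) (*-distribʳ-∑ (#IT (I - k)) (allFin m) _) ⟩
    ∑[ v ∈ allFin m ] (𝟙 (π v Fin.≟ k) * #IT (I - k))
      ≤⟨ ∑-mono (allFin m) (λ v → 𝟙*-mono (π v Fin.≟ k) (#IT-remove-vertex k∈I)) ⟩
    ∑[ v ∈ allFin m ] (𝟙 (π v Fin.≟ k)
                        * (∑[ Y ∈ allSubsets m ] (χ Y * 𝟙 (v ∈? Y)) + ∑[ e ∈ Eₖ ] (c e * 𝟙 (v ∈? e))))
      ≡⟨ trans (∑-cong (allFin m) (λ v → *-distribˡ-+ (𝟙 (π v Fin.≟ k)) _ _)) (∑-distrib-+ (allFin m) _ _) ⟩
    ∑[ v ∈ allFin m ] (𝟙 (π v Fin.≟ k) * ∑[ Y ∈ allSubsets m ] (χ Y * 𝟙 (v ∈? Y)))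
      + ∑[ v ∈ allFin m ] (𝟙 (π v Fin.≟ k) * ∑[ e ∈ Eₖ ] (c e * 𝟙 (v ∈? e)))
      ≡⟨ cong₂ _+_ (∑-part-weighted (allSubsets m) (λ Y → Y) χ k) (∑-part-weighted Eₖ (λ e → e) c k) ⟩
    ∑[ Y ∈ allSubsets m ] (χ Y * ∣ Y ∩ part π k ∣) + ∑[ e ∈ Eₖ ] (c e * ∣ e ∩ part π k ∣)
      ≤⟨ +-mono-≤ (∑-mono (allSubsets m) (λ Y → 𝟙*-≤ (independentTransversal? I Y) (≤-reflexive ∘ one-in-part)))
                  (∑-mono-∈ Eₖ (λ {e} e∈Eₖ → ≤-trans (*-monoʳ-≤ (c e) (stretched-in-part e∈Eₖ))
                                                     (≤-reflexive (*-identityʳ (c e))))) ⟩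
    #IT I + ∑[ e ∈ Eₖ ] c e ∎
    where
    open ≤-Reasoning
    Eₖ = stretchedMeetingEdges k
    χ : Subset m → ℕ
    χ Y = 𝟙 (independentTransversal? I Y)
    c : Subset m → ℕ
    c e = #IT⊇ (I - k) (e ─ part π k)
    one-in-part : ∀ {Y} → IndependentTransversal I Y → ∣ Y ∩ part π k ∣ ≡ 1
    one-in-part (Y-pt , _) = trans (PartialTransversal.part-count Y-pt k) (𝟙-yes (k ∈? I) k∈I)
    stretched-in-part : ∀ {e} → e ∈ₗ Eₖ → ∣ e ∩ part π k ∣ ≤ 1
    stretched-in-part e∈Eₖ = proj₁ (proj₂ (∈-filter⁻ (stretchedMeeting? k) {xs = edges G} e∈Eₖ)) k

-- The recursion and its iteration

^-step : ∀ {a b x y z} N → a ^ N * x ≤ b ^ N * y → a * y ≤ b * z → a ^ suc N * x ≤ b ^ suc N * z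
^-step {a} {b} {x} {y} {z} N aᴺx≤bᴺy ay≤bz = begin
  a * a ^ N * x    ≡⟨ *-assoc a (a ^ N) x ⟩
  a * (a ^ N * x)  ≤⟨ *-monoʳ-≤ a aᴺx≤bᴺy ⟩
  a * (b ^ N * y)  ≡⟨ x∙yz≈y∙xz a (b ^ N) y ⟩
  b ^ N * (a * y)  ≤⟨ *-monoʳ-≤ (b ^ N) ay≤bz ⟩
  b ^ N * (b * z)  ≡⟨ x∙yz≈y∙xz (b ^ N) b z ⟩
  b * (b ^ N * z)  ≡⟨ *-assoc b (b ^ N) z ⟨
  b * b ^ N * z    ∎
  where open ≤-Reasoning

^-distribʳ-* : ∀ x y n → (x * y) ^ n ≡ x ^ n * y ^ n
^-distribʳ-* x y zero    = refl
^-distribʳ-* x y (suc n) = trans (cong (x * y *_) (^-distribʳ-* x y n)) (*-interchange x y (x ^ n) (y ^ n))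

module Iteration {m n} (G : Hypergraph m) (π : Fin m → Fin n) (a b : ℕ) where

  open Partition π
  open IndependentTransversals G π

  RecursionUpTo : ℕ → Set
  RecursionUpTo s = ∀ {I k} → ∣ I ∣ ≤ s → k ∈ I → a * #IT (I - k) ≤ b * #IT I

  -- Delete the vertices of e one at a time; each deletion costs a factor b/a by the recursion.
  #IT⊇-bound : ∀ {s} → RecursionUpTo s → ∀ N {I e} → ∣ I ∣ ≤ s → ∣ e ∣ ≡ N → a ^ N * #IT⊇ I e ≤ b ^ N * #IT I
  #IT⊇-bound R zero    {I} {e} _ _ = *-monoʳ-≤ 1 (#IT⊇≤#IT I e)
  #IT⊇-bound R (suc N) {I} {e} ∣I∣≤s ∣e∣≡1+N with 1≤∣p∣⇒Nonempty e (subst (1 ≤_) (sym ∣e∣≡1+N) (s≤s z≤n))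
  ... | u , u∈e with π u ∈? I
  ...   | yes πu∈I = ≤-trans (*-monoʳ-≤ (a ^ suc N) (#IT⊇-remove u∈e))
                       (^-step N (#IT⊇-bound R N {I - π u} {e - u} ∣I-πu∣≤s ∣e-u∣≡N) (R ∣I∣≤s πu∈I))
    where
    ∣I-πu∣≤s = ≤-trans (∣p─q∣≤∣p∣ I ⁅ π u ⁆) ∣I∣≤s
    ∣e-u∣≡N = suc-injective (trans (sym (∣p∣≡1+∣p-x∣ u∈e)) ∣e∣≡1+N)
  ...   | no  πu∉I =
    ≤-trans (≤-reflexive (trans (cong (a ^ suc N *_) (#IT⊇-∉ u∈e πu∉I)) (*-zeroʳ (a ^ suc N)))) z≤n

  #IT-bound : (∀ {I k} → k ∈ I → a * #IT (I - k) ≤ b * #IT I) → ∀ N {I} → ∣ I ∣ ≡ N → a ^ N * #IT ⊥ ≤ b ^ N * #IT I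
  #IT-bound R zero    ∣I∣≡0 = *-monoʳ-≤ 1 (≤-reflexive (cong #IT (sym (∣p∣≡0⇒p≡⊥ ∣I∣≡0))))
  #IT-bound R (suc N) {I} ∣I∣≡1+N with 1≤∣p∣⇒Nonempty I (subst (1 ≤_) (sym ∣I∣≡1+N) (s≤s z≤n))
  ... | k , k∈I = ^-step N (#IT-bound R N (suc-injective (trans (sym (∣p∣≡1+∣p-x∣ k∈I)) ∣I∣≡1+N))) (R k∈I)

-- With b = r₁ + 1, multiplying the first inequality by b · A and substituting the other two
-- leaves r₁ · A · d · T′ ≤ b · A · T.
recursion-arithmetic : ∀ {r₁ t d A D T T′ S} → 1 ≤ A → t ≤ d →
  d * T′ ≤ T + S → A * S ≤ D * (suc r₁ ^ r₁ * T′) → D * suc r₁ ^ suc r₁ ≤ A * d →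
  r₁ * t * T′ ≤ suc r₁ * T
recursion-arithmetic {r₁} {d = d} {A@(suc _)} {D} {T} {T′} {S} _ t≤d dT′≤T+S AS≤Dbʳ¹T′ Dbᵇ≤Ad =
  ≤-trans (*-monoˡ-≤ T′ (*-monoʳ-≤ r₁ t≤d)) (*-cancelˡ-≤ A (+-cancelʳ-≤ (A * d * T′) _ _ (begin
    A * (r₁ * d * T′) + A * d * T′      ≡⟨ e₁ A r₁ d T′ ⟩
    b * A * (d * T′)                    ≤⟨ *-monoʳ-≤ (b * A) dT′≤T+S ⟩
    b * A * (T + S)                     ≡⟨ e₂ b A T S ⟩
    A * (b * T) + b * (A * S)           ≤⟨ +-monoʳ-≤ (A * (b * T)) (*-monoʳ-≤ b AS≤Dbʳ¹T′) ⟩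
    A * (b * T) + b * (D * (b ^ r₁ * T′)) ≡⟨ cong (A * (b * T) +_) (e₃ b D (b ^ r₁) T′) ⟩
    A * (b * T) + D * (b * b ^ r₁) * T′ ≤⟨ +-monoʳ-≤ (A * (b * T)) (*-monoˡ-≤ T′ Dbᵇ≤Ad) ⟩
    A * (b * T) + A * d * T′            ∎)))
  where
  open ≤-Reasoning
  b = suc r₁
  e₁ : ∀ A r₁ d T′ → A * (r₁ * d * T′) + A * d * T′ ≡ suc r₁ * A * (d * T′)
  e₁ = solve-∀
  e₂ : ∀ b A T S → b * A * (T + S) ≡ A * (b * T) + b * (A * S)
  e₂ = solve-∀
  e₃ : ∀ b D p T′ → b * (D * (p * T′)) ≡ D * (b * p) * T′
  e₃ = solve-∀

module LowerBound {m n} (G : Hypergraph m) (π : Fin m → Fin n) (r₁ t : ℕ) (1≤r₁ : 1 ≤ r₁) (1≤t : 1 ≤ t)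
  (uniform : Uniform (suc r₁) G) (large : ∀ i → t ≤ ∣ part π i ∣)
  (sparse : ∀ i → stretchedMeeting G π i * suc r₁ ^ suc r₁ ≤ r₁ ^ r₁ * t ^ r₁ * ∣ part π i ∣) where

  open Partition π
  open IndependentTransversals G π

  a b : ℕ
  a = r₁ * t
  b = suc r₁

  open Iteration G π a b

  ∣e─part∣≡r₁ : ∀ {k e} → e ∈ₗ stretchedMeetingEdges k → ∣ e ─ part π k ∣ ≡ r₁
  ∣e─part∣≡r₁ {k} {e} e∈Eₖ with ∈-filter⁻ (stretchedMeeting? k) {xs = edges G} e∈Eₖ
  ... | e∈G , stretched , (v , v∈e∩Vₖ) = suc-injective (begin
    suc ∣ e ─ part π k ∣                ≡⟨ cong (_+ ∣ e ─ part π k ∣) ∣e∩Vₖ∣≡1 ⟨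
    ∣ e ∩ part π k ∣ + ∣ e ─ part π k ∣ ≡⟨ ∣p∣≡∣p∩q∣+∣p─q∣ e (part π k) ⟨
    ∣ e ∣                               ≡⟨ uniform e e∈G ⟩
    suc r₁                              ∎)
    where
    open ≡-Reasoning
    ∣e∩Vₖ∣≡1 : ∣ e ∩ part π k ∣ ≡ 1
    ∣e∩Vₖ∣≡1 = ≤-antisym (stretched k) (x∈p⇒1≤∣p∣ v∈e∩Vₖ)

  recursion : ∀ s → RecursionUpTo s
  recursion zero    ∣I∣≤0   k∈I = contradiction (≤-trans (x∈p⇒1≤∣p∣ k∈I) ∣I∣≤0) λ ()
  recursion (suc s) {I} {k} ∣I∣≤1+s k∈I =
    recursion-arithmetic {r₁} {D = length Eₖ} 1≤aʳ¹ (large k) (#IT-step k∈I) blocked-bound sparse-at-k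
    where
    I' = I - k
    Eₖ = stretchedMeetingEdges k
    1≤aʳ¹ : 1 ≤ a ^ r₁
    1≤aʳ¹ = m^n>0 a {{>-nonZero (*-mono-≤ 1≤r₁ 1≤t)}} r₁
    ∣I'∣≤s : ∣ I' ∣ ≤ s
    ∣I'∣≤s = ≤-pred (subst (_≤ suc s) (∣p∣≡1+∣p-x∣ k∈I) ∣I∣≤1+s)
    blocked-bound : a ^ r₁ * ∑[ e ∈ Eₖ ] #IT⊇ I' (e ─ part π k) ≤ length Eₖ * (b ^ r₁ * #IT I')
    blocked-bound = begin
      a ^ r₁ * ∑[ e ∈ Eₖ ] #IT⊇ I' (e ─ part π k)   ≡⟨ *-distribˡ-∑ (a ^ r₁) Eₖ _ ⟩
      ∑[ e ∈ Eₖ ] (a ^ r₁ * #IT⊇ I' (e ─ part π k))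
        ≤⟨ ∑-mono-∈ Eₖ (λ {e} e∈Eₖ → #IT⊇-bound (recursion s) r₁ {I'} {e ─ part π k} ∣I'∣≤s (∣e─part∣≡r₁ e∈Eₖ)) ⟩
      ∑[ e ∈ Eₖ ] (b ^ r₁ * #IT I')                 ≡⟨ ∑-const Eₖ _ ⟩
      length Eₖ * (b ^ r₁ * #IT I')                 ∎
      where open ≤-Reasoning
    sparse-at-k : length Eₖ * b ^ b ≤ a ^ r₁ * ∣ part π k ∣
    sparse-at-k = subst (λ x → length Eₖ * b ^ b ≤ x * ∣ part π k ∣) (sym (^-distribʳ-* r₁ t r₁)) (sparse k)

  independentTransversals-bound : a ^ n ≤ numIndepTransversals G π * b ^ n
  independentTransversals-bound = begin
    a ^ n                              ≡⟨ *-identityʳ (a ^ n) ⟨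
    a ^ n * 1                          ≤⟨ *-monoʳ-≤ (a ^ n) (1≤# (independentTransversal? ⊥) ⊥-it) ⟩
    a ^ n * #IT ⊥                      ≤⟨ #IT-bound (recursion _ ≤-refl) n (∣⊤∣≡n n) ⟩
    b ^ n * #IT ⊤                      ≤⟨ *-monoʳ-≤ (b ^ n) #IT⊤≤ ⟩
    b ^ n * numIndepTransversals G π   ≡⟨ *-comm (b ^ n) _ ⟩
    numIndepTransversals G π * b ^ n   ∎
    where
    open ≤-Reasoning
    nonempty : ∀ {e} → e ∈ₗ edges G → Nonempty e
    nonempty {e} e∈G = 1≤∣p∣⇒Nonempty e (subst (1 ≤_) (sym (uniform e e∈G)) (s≤s z≤n))
    ⊥-it : IndependentTransversal ⊥ ⊥
    ⊥-it = partialTransversal-⊥ , independent-⊥ G nonempty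
    #IT⊤≤ : #IT ⊤ ≤ numIndepTransversals G π
    #IT⊤≤ = ≤-trans (#-mono (independentTransversal? ⊤) (λ X → transversal? π X ×-dec independent? G X)
                      (λ (X-pt , X-ind) → partialTransversal-⊤ X-pt , X-ind))
                    (≤-reflexive (sym (length-filter≡∑𝟙 _ (allSubsets m))))

theorem9 : (r t : ℕ) → r ≥ 2 → t ≥ 1 →
    {m n : ℕ} (G : Hypergraph m) → Uniform r G →
    (π : Fin m → Fin n) →
    (∀ i → ∣ part π i ∣ ≥ t) →
    (∀ i → stretchedMeeting G π i * r ^ r
    ≤ (r ∸ 1) ^ (r ∸ 1) * t ^ (r ∸ 1) * ∣ part π i ∣) →
    numIndepTransversals G π * r ^ n ≥ ((r ∸ 1) * t) ^ n
theorem9 (suc (suc r₀)) t (s≤s (s≤s z≤n)) 1≤t G uniform π large sparse =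
  LowerBound.independentTransversals-bound G π (suc r₀) t (s≤s z≤n) 1≤t uniform large sparse
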